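{- For every positive integer $n$, the maximum number of entries equal to $-1$ in an $n\times n$ square sign matrix is $\lfloor\frac{n-1}{2}\rfloor\lceil\frac{n-1}{2}\rceil$.
   Context: An $n\times n$ square sign matrix is an $n\times n$ matrix $A=(a_{ij})$ with entries in $\{0,1,-1\}$ such that all row sums and all column sums equal $1$, $0\le \sum_{i'=1}^{i}a_{i'j}\le 1$ for all $1\le i,j\le n$, and $\sum_{j'=1}^{j}a_{ij'}\ge 0$ for all $1\le i,j\le n$. -}

module Defs where

open import Data.Nat using (ℕ; zero; suc)
open import Data.Fin using (Fin; toℕ)
open import Data.Integer using (ℤ; 0ℤ; 1ℤ; -1ℤ; _+_; _≤_)
open import Data.Product using (_×_)
open import Data.Bool using (Bool; if_then_else_)
import Relation.Nullary
import Relation.Nullary.Decidable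
import Data.Fin
open import Relation.Binary.PropositionalEquality using (_≡_)
import Data.Nat as ℕ

-- sum of f over the indices 0 ≤ k < m (i.e. ∑_{k=1}^{m} in 1-based notation)
sumTo : (m : ℕ) → (ℕ → ℤ) → ℤ
sumTo zero    f = 0ℤ
sumTo (suc m) f = sumTo m f + f m

Matrix : ℕ → Set
Matrix n = Fin n → Fin n → ℤ

-- entry lookup on ℕ indices; out-of-range indices give 0 (never used below n)
at : {n : ℕ} → Matrix n → ℕ → ℕ → ℤ
at {n} A i j with i ℕ.<? n | j ℕ.<? n
... | Relation.Nullary.yes p | Relation.Nullary.yes q = A (Data.Fin.fromℕ< p) (Data.Fin.fromℕ< q)
... | _ | _ = 0ℤ

data IsSign : ℤ → Set where
  sign0  : IsSign 0ℤ
  sign1  : IsSign 1ℤ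
  signm1 : IsSign -1ℤ

record IsSquareSignMatrix (n : ℕ) (A : Matrix n) : Set where
  field
    entries    : ∀ i j → IsSign (A i j)
    rowSum     : ∀ (i : Fin n) → sumTo n (λ j → at A (toℕ i) j) ≡ 1ℤ
    colSum     : ∀ (j : Fin n) → sumTo n (λ i → at A i (toℕ j)) ≡ 1ℤ
    -- 0 ≤ ∑_{i' ≤ i} a_{i' j} ≤ 1   (prefix of length i+1 of column j)
    colPrefix  : ∀ (i j : Fin n) →
                 (0ℤ ≤ sumTo (suc (toℕ i)) (λ i' → at A i' (toℕ j)))
                 × (sumTo (suc (toℕ i)) (λ i' → at A i' (toℕ j)) ≤ 1ℤ)
    -- ∑_{j' ≤ j} a_{i j'} ≥ 0   (prefix of length j+1 of row i)
    rowPrefix  : ∀ (i j : Fin n) →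
                 0ℤ ≤ sumTo (suc (toℕ j)) (λ j' → at A (toℕ i) j')

countFin : (m : ℕ) → (Fin m → Bool) → ℕ
countFin zero    p = 0
countFin (suc m) p = (if p Data.Fin.zero then 1 else 0) ℕ.+ countFin m (λ k → p (Data.Fin.suc k))

isMinusOne : ℤ → Bool
isMinusOne x = Relation.Nullary.Decidable.⌊ x Data.Integer.≟ -1ℤ ⌋

numMinusOnes : {n : ℕ} → Matrix n → ℕ
numMinusOnes {n} A = sumℕ n (λ i → countFin n (λ j → isMinusOne (A i j)))
  where
    sumℕ : (m : ℕ) → (Fin m → ℕ) → ℕ
    sumℕ zero    f = 0
    sumℕ (suc m) f = f Data.Fin.zero ℕ.+ sumℕ m (λ k → f (Data.Fin.suc k))

-- Let p be the sum of column j over the rows above row i; the column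
-- condition makes p ∈ {0, 1}, and since every row sums to 1 the p's of row i add up
-- to i.  A -1 at (i, j) forces p = 1 and a 1 forces p = 0, so χ(a) ≤ p and
-- χ(a) + a + p ≤ 1 for every entry a, where χ counts the -1s.  Summed over row i these
-- say that the number m of -1s in the row satisfies m ≤ i and m + 1 + i ≤ n; the
-- minima min(i, n - 1 - i) add up to ⌊(n-1)/2⌋⌈(n-1)/2⌉.
--
-- With N = n - 1 and k = ⌊N/2⌋ put (-1)^(i+j+k) on the diamond
-- |i - j| ≤ k ≤ i + j ≤ 2N - k and 0 elsewhere.  The matrix is symmetric, and row i
-- reads 0 … 0, 1, -1, 1, …, -1, 1, 0 … 0 with min(i, N - i) entries -1, so its
-- prefix sums are 0 or 1 and the bound is attained.
module Submission where

open import Defs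

module Sums where

  open import Data.Nat as ℕ using (ℕ; zero; suc; _<_)
  import Data.Nat.Properties as ℕₚ
  open import Data.Integer using (ℤ; +_; 0ℤ; 1ℤ; _+_; _≤_)
  import Data.Integer.Properties as ℤₚ
  open import Data.Integer.Tactic.RingSolver using (solve-∀)
  open import Data.Product using (_×_)
  open import Function using (_∘_)
  open import Relation.Binary.PropositionalEquality

  Bit : ℤ → Set
  Bit x = 0ℤ ≤ x × x ≤ 1ℤ

  sumTo-cong : ∀ m {f g : ℕ → ℤ} → (∀ j → j < m → f j ≡ g j) → sumTo m f ≡ sumTo m g
  sumTo-cong zero    f≡g = refl
  sumTo-cong (suc m) f≡g =
    cong₂ _+_ (sumTo-cong m (λ j j<m → f≡g j (ℕₚ.m<n⇒m<1+n j<m))) (f≡g m ℕₚ.≤-refl)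

  sumTo-mono-≤ : ∀ m {f g : ℕ → ℤ} → (∀ j → j < m → f j ≤ g j) → sumTo m f ≤ sumTo m g
  sumTo-mono-≤ zero    f≤g = ℤₚ.≤-refl
  sumTo-mono-≤ (suc m) f≤g =
    ℤₚ.+-mono-≤ (sumTo-mono-≤ m (λ j j<m → f≤g j (ℕₚ.m<n⇒m<1+n j<m))) (f≤g m ℕₚ.≤-refl)

  sumTo-zero : ∀ m {f : ℕ → ℤ} → (∀ j → j < m → f j ≡ 0ℤ) → sumTo m f ≡ 0ℤ
  sumTo-zero zero    f≡0 = refl
  sumTo-zero (suc m) f≡0 =
    cong₂ _+_ (sumTo-zero m (λ j j<m → f≡0 j (ℕₚ.m<n⇒m<1+n j<m))) (f≡0 m ℕₚ.≤-refl)

  sumTo-1 : ∀ m → sumTo m (λ _ → 1ℤ) ≡ + m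
  sumTo-1 zero    = refl
  sumTo-1 (suc m) = trans (cong (_+ 1ℤ) (sumTo-1 m)) (cong +_ (ℕₚ.+-comm m 1))

  sumTo-suc : ∀ m (f : ℕ → ℤ) → sumTo (suc m) f ≡ f 0 + sumTo m (f ∘ suc)
  sumTo-suc zero    f = trans (ℤₚ.+-identityˡ (f 0)) (sym (ℤₚ.+-identityʳ (f 0)))
  sumTo-suc (suc m) f = trans (cong (_+ f (suc m)) (sumTo-suc m f)) (ℤₚ.+-assoc (f 0) _ _)

  sumTo-+ : ∀ a b (f : ℕ → ℤ) → sumTo (a ℕ.+ b) f ≡ sumTo a f + sumTo b (λ t → f (a ℕ.+ t))
  sumTo-+ a zero    f = trans (cong (λ m → sumTo m f) (ℕₚ.+-identityʳ a)) (sym (ℤₚ.+-identityʳ _))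
  sumTo-+ a (suc b) f = begin
    sumTo (a ℕ.+ suc b) f                                   ≡⟨ cong (λ m → sumTo m f) (ℕₚ.+-suc a b) ⟩
    sumTo (a ℕ.+ b) f + f (a ℕ.+ b)                         ≡⟨ cong (_+ f (a ℕ.+ b)) (sumTo-+ a b f) ⟩
    sumTo a f + sumTo b (λ t → f (a ℕ.+ t)) + f (a ℕ.+ b)   ≡⟨ ℤₚ.+-assoc (sumTo a f) _ _ ⟩
    sumTo a f + sumTo (suc b) (λ t → f (a ℕ.+ t))           ∎
    where open ≡-Reasoning

  sumTo-dropZeros : ∀ {lo m} {f : ℕ → ℤ} → (∀ j → j < lo → f j ≡ 0ℤ) → lo ℕ.≤ m →
                    sumTo m f ≡ sumTo (m ℕ.∸ lo) (λ t → f (lo ℕ.+ t))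
  sumTo-dropZeros {lo} {m} {f} f≡0 lo≤m = begin
    sumTo m f                           ≡⟨ cong (λ m → sumTo m f) (ℕₚ.m+[n∸m]≡n lo≤m) ⟨
    sumTo (lo ℕ.+ (m ℕ.∸ lo)) f         ≡⟨ sumTo-+ lo (m ℕ.∸ lo) f ⟩
    sumTo lo f + shifted                ≡⟨ cong (_+ shifted) (sumTo-zero lo f≡0) ⟩
    0ℤ + shifted                        ≡⟨ ℤₚ.+-identityˡ _ ⟩
    shifted                             ∎
    where
    open ≡-Reasoning
    shifted : ℤ
    shifted = sumTo (m ℕ.∸ lo) (λ t → f (lo ℕ.+ t))

  sumTo-distrib-+ : ∀ m (f g : ℕ → ℤ) → sumTo m (λ j → f j + g j) ≡ sumTo m f + sumTo m g
  sumTo-distrib-+ zero    f g = refl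
  sumTo-distrib-+ (suc m) f g =
    trans (cong (_+ (f m + g m)) (sumTo-distrib-+ m f g)) (interchange (sumTo m f) (sumTo m g) (f m) (g m))
    where
    interchange : ∀ a b c d → (a + b) + (c + d) ≡ (a + c) + (b + d)
    interchange = solve-∀

  sumTo-comm : ∀ a b (F : ℕ → ℕ → ℤ) →
               sumTo a (λ i → sumTo b (F i)) ≡ sumTo b (λ j → sumTo a (λ i → F i j))
  sumTo-comm zero    b F = sym (sumTo-zero b (λ _ _ → refl))
  sumTo-comm (suc a) b F = trans (cong (_+ sumTo b (F a)) (sumTo-comm a b F)) (sym (sumTo-distrib-+ b _ _))

module Counting where

  open Sums
  open import Data.Nat as ℕ using (ℕ; zero; suc)
  open import Data.Integer using (ℤ; +_; _+_)
  import Data.Integer.Properties as ℤₚ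
  open import Data.Fin as Fin using (Fin; toℕ)
  import Data.Fin.Properties as Finₚ
  open import Data.Vec.Functional using (foldr)
  open import Data.Bool using (if_then_else_)
  open import Function using (_∘_)
  open import Relation.Binary.PropositionalEquality
  open import Relation.Nullary using (yes; no)
  open import Relation.Nullary.Negation using (contradiction)

  χ₋₁ : ℤ → ℤ
  χ₋₁ x = + (if isMinusOne x then 1 else 0)

  at-fromℕ< : ∀ {n} (A : Matrix n) i j (i<n : i ℕ.< n) (j<n : j ℕ.< n) →
              at A i j ≡ A (Fin.fromℕ< i<n) (Fin.fromℕ< j<n)
  at-fromℕ< {n} A i j i<n j<n with i ℕ.<? n | j ℕ.<? n
  ... | yes _   | yes _   = refl
  ... | no i≮n  | _       = contradiction i<n i≮n
  ... | yes _   | no j≮n  = contradiction j<n j≮n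

  at-toℕ : ∀ {n} (A : Matrix n) (i j : Fin n) → at A (toℕ i) (toℕ j) ≡ A i j
  at-toℕ A i j = trans (at-fromℕ< A (toℕ i) (toℕ j) (Finₚ.toℕ<n i) (Finₚ.toℕ<n j))
                       (cong₂ A (Finₚ.fromℕ<-toℕ i (Finₚ.toℕ<n i)) (Finₚ.fromℕ<-toℕ j (Finₚ.toℕ<n j)))

  finSum-unique : {G : (m : ℕ) → (Fin m → ℕ) → ℕ} →
                  (∀ f → G 0 f ≡ 0) → (∀ m f → G (suc m) f ≡ f Fin.zero ℕ.+ G m (f ∘ Fin.suc)) →
                  ∀ m f → G m f ≡ foldr ℕ._+_ 0 f
  finSum-unique      G0 Gs zero    f = G0 f
  finSum-unique {G} G0 Gs (suc m) f =
    trans (Gs m f) (cong (f Fin.zero ℕ.+_) (finSum-unique {G} G0 Gs m (f ∘ Fin.suc)))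

  finSum≡sumTo : {X : Set} (G : (m : ℕ) → (Fin m → X) → ℕ) (w : X → ℕ) →
                 (∀ f → G 0 f ≡ 0) → (∀ m f → G (suc m) f ≡ w (f Fin.zero) ℕ.+ G m (f ∘ Fin.suc)) →
                 ∀ m f (g : ℕ → ℤ) → (∀ k → + w (f k) ≡ g (toℕ k)) → + G m f ≡ sumTo m g
  finSum≡sumTo G w G0 Gs zero    f g eq = cong +_ (G0 f)
  finSum≡sumTo G w G0 Gs (suc m) f g eq = begin
    + G (suc m) f                              ≡⟨ cong +_ (Gs m f) ⟩
    + (w (f Fin.zero) ℕ.+ G m (f ∘ Fin.suc))   ≡⟨ ℤₚ.pos-+ (w (f Fin.zero)) _ ⟩
    + w (f Fin.zero) + + G m (f ∘ Fin.suc)     ≡⟨ cong₂ _+_ (eq Fin.zero)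
                                                    (finSum≡sumTo G w G0 Gs m _ (g ∘ suc) (eq ∘ Fin.suc)) ⟩
    g 0 + sumTo m (g ∘ suc)                    ≡⟨ sym (sumTo-suc m g) ⟩
    sumTo (suc m) g                            ∎
    where open ≡-Reasoning

  rowMinusOnes : ∀ {n} → Matrix n → Fin n → ℕ
  rowMinusOnes {n} A i = countFin n (λ j → isMinusOne (A i j))

  -- The row sum inside numMinusOnes is a local function that cannot be named; the
  -- underscore in the type of numMinusOnes-local is solved by unification at its use
  -- in numMinusOnes≡foldr, after 'with suc m' has separated the size of A from the
  -- length of the remaining sum.
  mutual
    numMinusOnes-local : ∀ {w} (A : Matrix w) m (f : Fin m → ℕ) → _ ≡ foldr ℕ._+_ 0 f
    numMinusOnes-local A = finSum-unique (λ _ → refl) (λ _ _ → refl)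

    numMinusOnes≡foldr : ∀ {n} (A : Matrix n) → numMinusOnes A ≡ foldr ℕ._+_ 0 (rowMinusOnes A)
    numMinusOnes≡foldr {zero}  A = refl
    numMinusOnes≡foldr {suc m} A with rowMinusOnes A Fin.zero | rowMinusOnes A ∘ Fin.suc
    ... | r | rs with suc m
    ...   | w = cong (r ℕ.+_) (numMinusOnes-local {w} A m rs)

  numMinusOnes≡sumTo : ∀ {n} (A : Matrix n) →
                       + numMinusOnes A ≡ sumTo n (λ i → sumTo n (λ j → χ₋₁ (at A i j)))
  numMinusOnes≡sumTo {n} A = trans (cong +_ (numMinusOnes≡foldr A))
    (finSum≡sumTo (λ _ → foldr ℕ._+_ 0) (λ r → r) (λ _ → refl) (λ _ _ → refl) n _ _ λ i →
     finSum≡sumTo countFin (λ b → if b then 1 else 0) (λ _ → refl) (λ _ _ → refl) n _ _ λ j →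
     cong χ₋₁ (sym (at-toℕ A i j)))

module UpperBound where

  open Sums
  open Counting
  open import Data.Nat as ℕ using (ℕ; zero; suc; _∸_; _⊓_; z≤n; s≤s)
  import Data.Nat.Properties as ℕₚ
  open import Data.Integer using (ℤ; +_; 0ℤ; 1ℤ; -_; _+_; _≤_; +≤+)
  import Data.Integer.Properties as ℤₚ
  open import Data.Integer.Tactic.RingSolver using (solve-∀)
  import Data.Fin as Fin
  import Data.Fin.Properties as Finₚ
  open import Data.Product using (_×_; _,_; proj₁; proj₂)
  open import Data.Sum using (_⊎_; inj₁; inj₂)
  open import Function using (_∘_)
  open import Relation.Binary.PropositionalEquality

  rowBound : ℕ → ℕ → ℕ
  rowBound n i = i ⊓ (n ∸ suc i)

  bit-cases : ∀ {x} → Bit x → x ≡ 0ℤ ⊎ x ≡ 1ℤ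
  bit-cases {+ 0}           _                  = inj₁ refl
  bit-cases {+ 1}           _                  = inj₂ refl
  bit-cases {+ suc (suc _)} (_ , +≤+ (s≤s ()))

  χ₋₁-prefix-bounds : ∀ {p a} → IsSign a → Bit p → Bit (p + a) → χ₋₁ a ≤ p × χ₋₁ a + a + p ≤ 1ℤ
  χ₋₁-prefix-bounds _ p-bit _ with bit-cases p-bit
  χ₋₁-prefix-bounds sign0  _ _              | inj₁ refl = +≤+ z≤n , +≤+ z≤n
  χ₋₁-prefix-bounds sign1  _ _              | inj₁ refl = +≤+ z≤n , +≤+ (s≤s z≤n)
  χ₋₁-prefix-bounds signm1 _ (() , _)       | inj₁ refl
  χ₋₁-prefix-bounds sign0  _ _              | inj₂ refl = +≤+ z≤n , +≤+ (s≤s z≤n)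
  χ₋₁-prefix-bounds sign1  _ (_ , +≤+ (s≤s ())) | inj₂ refl
  χ₋₁-prefix-bounds signm1 _ _              | inj₂ refl = +≤+ (s≤s z≤n) , +≤+ (s≤s z≤n)

  +-cancelʳ-≤ : ∀ x y c → x + c ≤ y + c → x ≤ y
  +-cancelʳ-≤ x y c x+c≤y+c = subst₂ _≤_ (cancel x c) (cancel y c) (ℤₚ.+-monoˡ-≤ (- c) x+c≤y+c)
    where
    cancel : ∀ z c → z + c + - c ≡ z
    cancel = solve-∀

  module _ {n} {A : Matrix n} (S : IsSquareSignMatrix n A) where

    open IsSquareSignMatrix S

    above : ℕ → ℕ → ℤ
    above i j = sumTo i (λ i′ → at A i′ j)

    entry-sign : ∀ {i j} → i ℕ.< n → j ℕ.< n → IsSign (at A i j)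
    entry-sign i<n j<n = subst IsSign (sym (at-fromℕ< A _ _ i<n j<n)) (entries _ _)

    above-bit : ∀ {i j} → i ℕ.≤ n → j ℕ.< n → Bit (above i j)
    above-bit {zero}  _   _   = +≤+ z≤n , +≤+ z≤n
    above-bit {suc i} {j} i<n j<n =
      subst Bit (cong₂ (λ i j → sumTo (suc i) (λ i′ → at A i′ j)) (Finₚ.toℕ-fromℕ< i<n) (Finₚ.toℕ-fromℕ< j<n))
                (colPrefix (Fin.fromℕ< i<n) (Fin.fromℕ< j<n))

    row-sum : ∀ {i} → i ℕ.< n → sumTo n (at A i) ≡ 1ℤ
    row-sum i<n = subst (λ i → sumTo n (at A i) ≡ 1ℤ) (Finₚ.toℕ-fromℕ< i<n) (rowSum (Fin.fromℕ< i<n))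

    above-sum : ∀ {i} → i ℕ.≤ n → sumTo n (above i) ≡ + i
    above-sum {i} i≤n = begin
      sumTo n (above i)                       ≡⟨ sumTo-comm i n (at A) ⟨
      sumTo i (λ i′ → sumTo n (at A i′))      ≡⟨ sumTo-cong i (λ i′ i′<i → row-sum (ℕₚ.<-≤-trans i′<i i≤n)) ⟩
      sumTo i (λ _ → 1ℤ)                      ≡⟨ sumTo-1 i ⟩
      + i                                     ∎
      where open ≡-Reasoning

    minusOnes : ℕ → ℤ
    minusOnes i = sumTo n (χ₋₁ ∘ at A i)

    entry-bounds : ∀ {i j} → i ℕ.< n → j ℕ.< n →
                   χ₋₁ (at A i j) ≤ above i j × χ₋₁ (at A i j) + at A i j + above i j ≤ 1ℤ
    entry-bounds i<n j<n = χ₋₁-prefix-bounds (entry-sign i<n j<n) (above-bit (ℕₚ.<⇒≤ i<n) j<n) (above-bit i<n j<n)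

    minusOnes≤i : ∀ {i} → i ℕ.< n → minusOnes i ≤ + i
    minusOnes≤i i<n = ℤₚ.≤-trans (sumTo-mono-≤ n (λ j j<n → proj₁ (entry-bounds i<n j<n)))
                                 (ℤₚ.≤-reflexive (above-sum (ℕₚ.<⇒≤ i<n)))

    minusOnes≤n∸suc : ∀ {i} → i ℕ.< n → minusOnes i ≤ + (n ∸ suc i)
    minusOnes≤n∸suc {i} i<n = +-cancelʳ-≤ (minusOnes i) (+ (n ∸ suc i)) (+ suc i) (begin
      minusOnes i + + suc i
        ≡⟨ regroup (minusOnes i) (+ i) ⟩
      minusOnes i + 1ℤ + + i
        ≡⟨ cong₂ (λ r a → minusOnes i + r + a) (row-sum i<n) (above-sum (ℕₚ.<⇒≤ i<n)) ⟨
      minusOnes i + sumTo n (at A i) + sumTo n (above i)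
        ≡⟨ cong (_+ sumTo n (above i)) (sumTo-distrib-+ n _ _) ⟨
      sumTo n (λ j → χ₋₁ (at A i j) + at A i j) + sumTo n (above i)
        ≡⟨ sumTo-distrib-+ n _ _ ⟨
      sumTo n (λ j → χ₋₁ (at A i j) + at A i j + above i j)
        ≤⟨ sumTo-mono-≤ n (λ j j<n → proj₂ (entry-bounds i<n j<n)) ⟩
      sumTo n (λ _ → 1ℤ)
        ≡⟨ sumTo-1 n ⟩
      + n
        ≡⟨ cong +_ (ℕₚ.m∸n+n≡m i<n) ⟨
      + (n ∸ suc i ℕ.+ suc i)
        ≡⟨ ℤₚ.pos-+ (n ∸ suc i) (suc i) ⟩
      + (n ∸ suc i) + + suc i
        ∎)
      where
      open ℤₚ.≤-Reasoning
      regroup : ∀ x y → x + (1ℤ + y) ≡ x + 1ℤ + y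
      regroup = solve-∀

    numMinusOnes≤sumTo-rowBound : + numMinusOnes A ≤ sumTo n (λ i → + rowBound n i)
    numMinusOnes≤sumTo-rowBound = ℤₚ.≤-trans (ℤₚ.≤-reflexive (numMinusOnes≡sumTo A))
      (sumTo-mono-≤ n (λ i i<n → ℤₚ.⊓-glb (minusOnes≤i i<n) (minusOnes≤n∸suc i<n)))

module ClosedForm where

  open Sums
  open UpperBound using (rowBound; numMinusOnes≤sumTo-rowBound)
  open import Data.Nat as ℕ using (ℕ; zero; suc; _+_; _*_; _∸_; _⊓_; _≤_; ⌊_/2⌋; ⌈_/2⌉)
  import Data.Nat.Properties as ℕₚ
  open import Data.Nat.Tactic.RingSolver using (solve-∀)
  open import Data.Integer as ℤ using (+_; 1ℤ)
  import Data.Integer.Properties as ℤₚ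
  open import Relation.Binary.PropositionalEquality

  maxMinusOnes : ℕ → ℕ
  maxMinusOnes n = ⌊ n ∸ 1 /2⌋ * ⌈ n ∸ 1 /2⌉

  maxMinusOnes-suc-suc : ∀ m → maxMinusOnes (suc (suc m)) ≡ m + maxMinusOnes m
  maxMinusOnes-suc-suc zero    = refl
  maxMinusOnes-suc-suc (suc m) =
    trans (expand ⌊ m /2⌋ ⌈ m /2⌉) (cong (λ s → suc (s + maxMinusOnes (suc m))) (ℕₚ.⌊n/2⌋+⌈n/2⌉≡n m))
    where
    expand : ∀ a b → suc a * suc b ≡ suc (a + b + a * b)
    expand = solve-∀

  rowBound-suc-suc : ∀ {m i} → i ℕ.< m → rowBound (suc (suc m)) (suc i) ≡ suc (rowBound m i)
  rowBound-suc-suc {m} {i} i<m = cong (suc i ⊓_) (ℕₚ.+-∸-assoc 1 i<m)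

  sumTo-rowBound : ∀ n → sumTo n (λ i → + rowBound n i) ≡ + maxMinusOnes n
  sumTo-rowBound zero          = refl
  sumTo-rowBound (suc zero)    = refl
  sumTo-rowBound (suc (suc m)) = begin
    sumTo (suc (suc m)) (λ i → + rowBound (suc (suc m)) i)
      ≡⟨ sumTo-suc (suc m) _ ⟩
    + 0 ℤ.+ (sumTo m (λ i → + rowBound (suc (suc m)) (suc i)) ℤ.+ + (suc m ⊓ (m ∸ m)))
      ≡⟨ cong₂ (λ s t → + 0 ℤ.+ (s ℤ.+ + (suc m ⊓ t)))
               (sumTo-cong m (λ i i<m → cong +_ (rowBound-suc-suc i<m))) (ℕₚ.n∸n≡0 m) ⟩
    + 0 ℤ.+ (sumTo m (λ i → 1ℤ ℤ.+ + rowBound m i) ℤ.+ + 0)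
      ≡⟨ trans (ℤₚ.+-identityˡ _) (ℤₚ.+-identityʳ _) ⟩
    sumTo m (λ i → 1ℤ ℤ.+ + rowBound m i)
      ≡⟨ sumTo-distrib-+ m _ _ ⟩
    sumTo m (λ _ → 1ℤ) ℤ.+ sumTo m (λ i → + rowBound m i)
      ≡⟨ cong₂ ℤ._+_ (sumTo-1 m) (sumTo-rowBound m) ⟩
    + m ℤ.+ + maxMinusOnes m
      ≡⟨ ℤₚ.pos-+ m _ ⟨
    + (m + maxMinusOnes m)
      ≡⟨ cong +_ (maxMinusOnes-suc-suc m) ⟨
    + maxMinusOnes (suc (suc m))
      ∎
    where open ≡-Reasoning

  numMinusOnes≤maxMinusOnes : ∀ {n} {A : Matrix n} → IsSquareSignMatrix n A → numMinusOnes A ≤ maxMinusOnes n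
  numMinusOnes≤maxMinusOnes {n} S =
    ℤₚ.drop‿+≤+ (ℤₚ.≤-trans (numMinusOnes≤sumTo-rowBound S) (ℤₚ.≤-reflexive (sumTo-rowBound n)))

module Pulse where

  open Sums
  open Counting using (χ₋₁)
  open import Data.Nat as ℕ using (ℕ; zero; suc; _≤_; _<_; z≤n; s≤s)
  import Data.Nat.Properties as ℕₚ
  open import Data.Integer using (ℤ; +_; 0ℤ; 1ℤ; -1ℤ; _+_; +≤+)
  open import Data.Integer.Tactic.RingSolver using (solve)
  open import Data.List using ([]; _∷_)
  open import Data.Product using (_,_)
  open import Function using (_∘_)
  open import Relation.Binary.PropositionalEquality
  open import Relation.Nullary using (yes; no)

  alt : ℕ → ℤ
  alt zero          = 1ℤ
  alt (suc zero)    = -1ℤ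
  alt (suc (suc t)) = alt t

  alt-sign : ∀ t → IsSign (alt t)
  alt-sign zero          = sign1
  alt-sign (suc zero)    = signm1
  alt-sign (suc (suc t)) = alt-sign t

  alt-+-even : ∀ a t → alt (a ℕ.+ a ℕ.+ t) ≡ alt t
  alt-+-even zero    t = refl
  alt-+-even (suc a) t rewrite ℕₚ.+-suc a a = alt-+-even a t

  pulse : ℕ → ℕ → ℤ
  pulse zero    zero          = 1ℤ
  pulse zero    (suc t)       = 0ℤ
  pulse (suc h) zero          = 1ℤ
  pulse (suc h) (suc zero)    = -1ℤ
  pulse (suc h) (suc (suc t)) = pulse h t

  pulse≡alt : ∀ h {t} → t ≤ h ℕ.+ h → pulse h t ≡ alt t
  pulse≡alt zero    {zero}        _        = refl
  pulse≡alt (suc h) {zero}        _        = refl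
  pulse≡alt (suc h) {suc zero}    _        = refl
  pulse≡alt (suc h) {suc (suc t)} (s≤s t≤) = pulse≡alt h (ℕₚ.≤-pred (subst (suc t ≤_) (ℕₚ.+-suc h h) t≤))

  pulse≡0 : ∀ h {t} → h ℕ.+ h < t → pulse h t ≡ 0ℤ
  pulse≡0 zero    {suc t}       _        = refl
  pulse≡0 (suc h) {suc (suc t)} (s≤s <t) = pulse≡0 h (ℕₚ.≤-pred (subst (_< suc t) (ℕₚ.+-suc h h) <t))

  sumTo-suc-suc : ∀ m (f : ℕ → ℤ) → sumTo (suc (suc m)) f ≡ f 0 + (f 1 + sumTo m (f ∘ suc ∘ suc))
  sumTo-suc-suc m f = trans (sumTo-suc (suc m) f) (cong (λ s → f 0 + s) (sumTo-suc m (f ∘ suc)))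

  sumTo-pulse-suc : ∀ h m → sumTo (suc (suc m)) (pulse (suc h)) ≡ sumTo m (pulse h)
  sumTo-pulse-suc h m = trans (sumTo-suc-suc m (pulse (suc h))) (cancel (sumTo m (pulse h)))
    where
    cancel : ∀ s → 1ℤ + (-1ℤ + s) ≡ s
    cancel s = solve (s ∷ [])

  sumTo-pulse-bit : ∀ h m → Bit (sumTo m (pulse h))
  sumTo-pulse-bit h       zero          = +≤+ z≤n , +≤+ z≤n
  sumTo-pulse-bit zero    (suc m)       =
    subst Bit (sym (trans (sumTo-suc m (pulse zero)) (cong (_+_ 1ℤ) (sumTo-zero m (λ _ _ → refl)))))
              (+≤+ z≤n , +≤+ (s≤s z≤n))
  sumTo-pulse-bit (suc h) (suc zero)    = +≤+ z≤n , +≤+ (s≤s z≤n)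
  sumTo-pulse-bit (suc h) (suc (suc m)) = subst Bit (sym (sumTo-pulse-suc h m)) (sumTo-pulse-bit h m)

  sumTo-pulse : ∀ h {m} → h ℕ.+ h < m → sumTo m (pulse h) ≡ 1ℤ
  sumTo-pulse zero    {suc m}       _        =
    trans (sumTo-suc m (pulse zero)) (cong (_+_ 1ℤ) (sumTo-zero m (λ _ _ → refl)))
  sumTo-pulse (suc h) {suc (suc m)} (s≤s <m) =
    trans (sumTo-pulse-suc h m) (sumTo-pulse h (ℕₚ.≤-pred (subst (_< suc m) (ℕₚ.+-suc h h) <m)))

  sumTo-χ₋₁-pulse : ∀ h {m} → h ℕ.+ h < m → sumTo m (χ₋₁ ∘ pulse h) ≡ + h
  sumTo-χ₋₁-pulse zero    {suc m}       _        =
    trans (sumTo-suc m (χ₋₁ ∘ pulse zero)) (cong (_+_ 0ℤ) (sumTo-zero m (λ _ _ → refl)))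
  sumTo-χ₋₁-pulse (suc h) {suc (suc m)} (s≤s <m) =
    trans (sumTo-suc-suc m (χ₋₁ ∘ pulse (suc h)))
          (cong (λ s → 0ℤ + (1ℤ + s)) (sumTo-χ₋₁-pulse h (ℕₚ.≤-pred (subst (_< suc m) (ℕₚ.+-suc h h) <m))))

  record ShiftedPulse (g : ℕ → ℤ) (lo h : ℕ) : Set where
    field
      zero-before : ∀ j → j < lo → g j ≡ 0ℤ
      pulse-from  : ∀ t → g (lo ℕ.+ t) ≡ pulse h t

  module _ {g : ℕ → ℤ} {lo h : ℕ} (P : ShiftedPulse g lo h) where

    open ShiftedPulse P

    sumTo-shifted : ∀ {m} (φ : ℤ → ℤ) → φ 0ℤ ≡ 0ℤ → lo ≤ m →
                    sumTo m (φ ∘ g) ≡ sumTo (m ℕ.∸ lo) (φ ∘ pulse h)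
    sumTo-shifted {m} φ φ0 lo≤m =
      trans (sumTo-dropZeros (λ j j<lo → trans (cong φ (zero-before j j<lo)) φ0) lo≤m)
            (sumTo-cong (m ℕ.∸ lo) (λ t _ → cong φ (pulse-from t)))

    sumTo-shifted-bit : ∀ m → Bit (sumTo m g)
    sumTo-shifted-bit m with m ℕ.≤? lo
    ... | yes m≤lo = subst Bit (sym (sumTo-zero m (λ j j<m → zero-before j (ℕₚ.<-≤-trans j<m m≤lo))))
                               (+≤+ z≤n , +≤+ z≤n)
    ... | no  m≰lo = subst Bit (sym (sumTo-shifted (λ x → x) refl (ℕₚ.<⇒≤ (ℕₚ.≰⇒> m≰lo))))
                               (sumTo-pulse-bit h (m ℕ.∸ lo))

    module _ {m} (lo+2h<m : lo ℕ.+ (h ℕ.+ h) < m) where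

      private
        lo≤m : lo ≤ m
        lo≤m = ℕₚ.≤-trans (ℕₚ.m≤m+n lo (h ℕ.+ h)) (ℕₚ.<⇒≤ lo+2h<m)

        2h<m∸lo : h ℕ.+ h < m ℕ.∸ lo
        2h<m∸lo = ℕₚ.m+n≤o⇒m≤o∸n (suc (h ℕ.+ h)) (subst (_≤ m) (cong suc (ℕₚ.+-comm lo _)) lo+2h<m)

      sumTo-shifted-total : sumTo m g ≡ 1ℤ
      sumTo-shifted-total = trans (sumTo-shifted (λ x → x) refl lo≤m) (sumTo-pulse h 2h<m∸lo)

      sumTo-χ₋₁-shifted : sumTo m (χ₋₁ ∘ g) ≡ + h
      sumTo-χ₋₁-shifted = trans (sumTo-shifted χ₋₁ refl lo≤m) (sumTo-χ₋₁-pulse h 2h<m∸lo)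

module Diamond where

  open Pulse
  open UpperBound using (rowBound)
  open import Data.Nat using (ℕ; suc; _+_; _∸_; _⊓_; _≤_; _<_; _≤?_)
  import Data.Nat.Properties as ℕₚ
  open import Data.Nat.Tactic.RingSolver using (solve)
  open import Data.Integer using (ℤ; 0ℤ)
  open import Data.List using ([]; _∷_)
  open import Data.Bool using (true; false; if_then_else_)
  open import Data.Product using (_×_; _,_)
  open import Function using (_∘_)
  open import Relation.Binary.PropositionalEquality
  open import Relation.Nullary using (Dec; yes; no; does; ¬_)
  open import Relation.Nullary.Decidable using (_×-dec_; dec-true; dec-false)

  InDiamond : (k N i j : ℕ) → Set
  InDiamond k N i j = k ≤ i + j × i + j + k ≤ N + N × j ≤ i + k × i ≤ j + k

  inDiamond? : ∀ k N i j → Dec (InDiamond k N i j)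
  inDiamond? k N i j = k ≤? i + j ×-dec i + j + k ≤? N + N ×-dec j ≤? i + k ×-dec i ≤? j + k

  diamond : (k N i j : ℕ) → ℤ
  diamond k N i j = if does (inDiamond? k N i j) then alt (i + j + k) else 0ℤ

  module _ (k N : ℕ) where

    diamond-inside : ∀ i j → InDiamond k N i j → diamond k N i j ≡ alt (i + j + k)
    diamond-inside i j p rewrite dec-true (inDiamond? k N i j) p = refl

    diamond-outside : ∀ i j → ¬ InDiamond k N i j → diamond k N i j ≡ 0ℤ
    diamond-outside i j ¬p rewrite dec-false (inDiamond? k N i j) ¬p = refl

    InDiamond-sym : ∀ {i j} → InDiamond k N i j → InDiamond k N j i
    InDiamond-sym {i} {j} (k≤i+j , i+j+k≤2N , j≤i+k , i≤j+k) =
      subst (k ≤_) (ℕₚ.+-comm i j) k≤i+j , subst (λ s → s + k ≤ N + N) (ℕₚ.+-comm i j) i+j+k≤2N , i≤j+k , j≤i+k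

    diamond-sym : ∀ i j → diamond k N j i ≡ diamond k N i j
    diamond-sym i j with inDiamond? k N i j
    ... | yes p = trans (diamond-inside j i (InDiamond-sym p))
                        (trans (cong (λ s → alt (s + k)) (ℕₚ.+-comm j i)) (sym (diamond-inside i j p)))
    ... | no ¬p = trans (diamond-outside j i (¬p ∘ InDiamond-sym)) (sym (diamond-outside i j ¬p))

    diamond-sign : ∀ i j → IsSign (diamond k N i j)
    diamond-sign i j with does (inDiamond? k N i j)
    ... | true  = alt-sign (i + j + k)
    ... | false = sign0

  record PulseRow (k N i : ℕ) : Set where
    field
      lo    : ℕ
      fits  : lo + (rowBound (suc N) i + rowBound (suc N) i) ≤ N
      shape : ShiftedPulse (diamond k N i) lo (rowBound (suc N) i)

  ≤-by : ∀ {a b} c → a + c ≡ b → a ≤ b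
  ≤-by {a} c a+c≡b = subst (a ≤_) a+c≡b (ℕₚ.m≤m+n a c)

  diamond-row-upper : ∀ {k N i} d v → i + d ≡ k → k + k + v ≡ N → PulseRow k N i
  diamond-row-upper {i = i} d v refl refl = record
    { lo    = d
    ; fits  = subst (λ h → d + (h + h) ≤ i + d + (i + d) + v) (sym rowBound≡i)
                    (≤-by (d + v) (solve (i ∷ d ∷ v ∷ [])))
    ; shape = subst (ShiftedPulse (diamond k N i) d) (sym rowBound≡i)
                    (record { zero-before = before ; pulse-from = from })
    }
    where
    k N : ℕ
    k = i + d
    N = k + k + v

    rowBound≡i : i ⊓ (i + d + (i + d) + v ∸ i) ≡ i
    rowBound≡i = ℕₚ.m≤n⇒m⊓n≡m (ℕₚ.m+n≤o⇒m≤o∸n i {i} (≤-by (d + d + v) (solve (i ∷ d ∷ v ∷ []))))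

    before : ∀ j → j < d → diamond k N i j ≡ 0ℤ
    before j j<d = diamond-outside k N i j (λ (k≤i+j , _) → ℕₚ.<⇒≱ (ℕₚ.+-monoʳ-< i j<d) k≤i+j)

    inside : ∀ {t} → t ≤ i + i → InDiamond (i + d) (i + d + (i + d) + v) i (d + t)
    inside {t} t≤2i =
        ≤-by t (solve (i ∷ d ∷ t ∷ []))
      , (begin
          i + (d + t) + (i + d)                   ≤⟨ ℕₚ.+-monoˡ-≤ (i + d) (ℕₚ.+-monoʳ-≤ i (ℕₚ.+-monoʳ-≤ d t≤2i)) ⟩
          i + (d + (i + i)) + (i + d)             ≤⟨ ≤-by (d + d + v + v) (solve (i ∷ d ∷ v ∷ [])) ⟩
          i + d + (i + d) + v + (i + d + (i + d) + v) ∎)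
      , (begin
          d + t                                   ≤⟨ ℕₚ.+-monoʳ-≤ d t≤2i ⟩
          d + (i + i)                             ≡⟨ solve (i ∷ d ∷ []) ⟩
          i + (i + d)                             ∎)
      , ≤-by (d + t + d) (solve (i ∷ d ∷ t ∷ []))
      where open ℕₚ.≤-Reasoning

    from : ∀ t → diamond k N i (d + t) ≡ pulse i t
    from t with t ≤? i + i
    ... | yes t≤2i = begin
      diamond k N i (d + t)             ≡⟨ diamond-inside k N i (d + t) (inside t≤2i) ⟩
      alt (i + (d + t) + (i + d))       ≡⟨ cong alt regroup ⟩
      alt (i + d + (i + d) + t)         ≡⟨ alt-+-even (i + d) t ⟩
      alt t                             ≡⟨ pulse≡alt i t≤2i ⟨
      pulse i t                         ∎
      where
      open ≡-Reasoning
      regroup : i + (d + t) + (i + d) ≡ i + d + (i + d) + t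
      regroup = solve (i ∷ d ∷ t ∷ [])
    ... | no t≰2i = trans (diamond-outside k N i (d + t) (λ (_ , _ , j≤i+k , _) →
                            t≰2i (ℕₚ.+-cancelˡ-≤ d t (i + i) (begin
                              d + t            ≤⟨ j≤i+k ⟩
                              i + (i + d)      ≡⟨ solve (i ∷ d ∷ []) ⟩
                              d + (i + i)      ∎))))
                          (sym (pulse≡0 i (ℕₚ.≰⇒> t≰2i)))
      where open ℕₚ.≤-Reasoning

  diamond-row-lower : ∀ {k N i} r w d → r + w ≡ k → k + suc d ≡ i → i + r ≡ N → PulseRow k N i
  diamond-row-lower r w d refl refl refl = record
    { lo    = suc d
    ; fits  = subst (λ h → suc d + (h + h) ≤ r + w + suc d + r) (sym rowBound≡r)
                    (≤-by w (solve (r ∷ w ∷ d ∷ [])))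
    ; shape = subst (ShiftedPulse (diamond k N i) (suc d)) (sym rowBound≡r)
                    (record { zero-before = before ; pulse-from = from })
    }
    where
    k i N : ℕ
    k = r + w
    i = k + suc d
    N = i + r

    rowBound≡r : i ⊓ (N ∸ i) ≡ r
    rowBound≡r = trans (cong (i ⊓_) (ℕₚ.m+n∸m≡n i r))
                       (ℕₚ.m≥n⇒m⊓n≡n (≤-by (w + suc d) (solve (r ∷ w ∷ d ∷ []))))

    before : ∀ j → j < suc d → diamond k N i j ≡ 0ℤ
    before j j<1+d = diamond-outside k N i j (λ (_ , _ , _ , i≤j+k) →
      ℕₚ.<⇒≱ (ℕₚ.+-monoˡ-< k j<1+d) (subst (_≤ j + k) (ℕₚ.+-comm k (suc d)) i≤j+k))

    inside : ∀ {t} → t ≤ r + r → InDiamond (r + w) (r + w + suc d + r) (r + w + suc d) (suc d + t)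
    inside {t} t≤2r =
        ≤-by (suc d + suc d + t) (solve (r ∷ w ∷ d ∷ t ∷ []))
      , (begin
          r + w + suc d + (suc d + t) + (r + w)
            ≤⟨ ℕₚ.+-monoˡ-≤ (r + w) (ℕₚ.+-monoʳ-≤ (r + w + suc d) (ℕₚ.+-monoʳ-≤ (suc d) t≤2r)) ⟩
          r + w + suc d + (suc d + (r + r)) + (r + w)   ≡⟨ solve (r ∷ w ∷ d ∷ []) ⟩
          r + w + suc d + r + (r + w + suc d + r)       ∎)
      , (begin
          suc d + t                                     ≤⟨ ℕₚ.+-monoʳ-≤ (suc d) t≤2r ⟩
          suc d + (r + r)                               ≤⟨ ≤-by (w + w) (solve (r ∷ w ∷ d ∷ [])) ⟩
          r + w + suc d + (r + w)                       ∎)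
      , ≤-by t (solve (r ∷ w ∷ d ∷ t ∷ []))
      where open ℕₚ.≤-Reasoning

    from : ∀ t → diamond k N i (suc d + t) ≡ pulse r t
    from t with t ≤? r + r
    ... | yes t≤2r = begin
      diamond k N i (suc d + t)                       ≡⟨ diamond-inside k N i (suc d + t) (inside t≤2r) ⟩
      alt (r + w + suc d + (suc d + t) + (r + w))     ≡⟨ cong alt regroup ⟩
      alt (r + w + suc d + (r + w + suc d) + t)       ≡⟨ alt-+-even (r + w + suc d) t ⟩
      alt t                                           ≡⟨ pulse≡alt r t≤2r ⟨
      pulse r t                                       ∎
      where
      open ≡-Reasoning
      regroup : r + w + suc d + (suc d + t) + (r + w) ≡ r + w + suc d + (r + w + suc d) + t
      regroup = solve (r ∷ w ∷ d ∷ t ∷ [])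
    ... | no t≰2r = trans (diamond-outside k N i (suc d + t) (λ (_ , i+j+k≤2N , _) →
                            t≰2r (ℕₚ.+-cancelˡ-≤ (i + suc d + k) t (r + r) (begin
                              r + w + suc d + suc d + (r + w) + t       ≡⟨ solve (r ∷ w ∷ d ∷ t ∷ []) ⟩
                              r + w + suc d + (suc d + t) + (r + w)     ≤⟨ i+j+k≤2N ⟩
                              r + w + suc d + r + (r + w + suc d + r)   ≡⟨ solve (r ∷ w ∷ d ∷ []) ⟩
                              r + w + suc d + suc d + (r + w) + (r + r) ∎))))
                          (sym (pulse≡0 r (ℕₚ.≰⇒> t≰2r)))
      where open ℕₚ.≤-Reasoning

  diamond-row : ∀ {k N i} → k + k ≤ N → N ≤ suc (k + k) → i ≤ N → PulseRow k N i
  diamond-row {k} {N} {i} 2k≤N N≤2k+1 i≤N with i ≤? k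
  ... | yes i≤k = diamond-row-upper (k ∸ i) (N ∸ (k + k)) (ℕₚ.m+[n∸m]≡n i≤k) (ℕₚ.m+[n∸m]≡n 2k≤N)
  ... | no  i≰k = diamond-row-lower (N ∸ i) (k ∸ (N ∸ i)) (i ∸ suc k)
                    (ℕₚ.m+[n∸m]≡n N∸i≤k) (trans (ℕₚ.+-suc k _) (ℕₚ.m+[n∸m]≡n k<i)) (ℕₚ.m+[n∸m]≡n i≤N)
    where
    k<i : k < i
    k<i = ℕₚ.≰⇒> i≰k
    N∸i≤k : N ∸ i ≤ k
    N∸i≤k = ℕₚ.≤-trans (ℕₚ.∸-mono N≤2k+1 k<i) (ℕₚ.≤-reflexive (ℕₚ.m+n∸m≡n k k))

module Construction where

  open Sums
  open Counting
  open UpperBound using (rowBound)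
  open ClosedForm
  open Pulse
  open Diamond
  open import Data.Nat using (ℕ; suc; _+_; _≤_; _<_; ⌊_/2⌋; s≤s)
  import Data.Nat.Properties as ℕₚ
  open import Data.Integer as ℤ using (+_; 0ℤ; 1ℤ)
  import Data.Integer.Properties as ℤₚ
  open import Data.Fin using (toℕ)
  import Data.Fin.Properties as Finₚ
  open import Data.Product using (proj₁)
  open import Function using (_∘_)
  open import Relation.Binary.PropositionalEquality

  module _ (N : ℕ) where

    k : ℕ
    k = ⌊ N /2⌋

    2k≤N : k + k ≤ N
    2k≤N = subst (k + k ≤_) (ℕₚ.⌊n/2⌋+⌈n/2⌉≡n N) (ℕₚ.+-monoʳ-≤ k (ℕₚ.⌊n/2⌋≤⌈n/2⌉ N))

    N≤2k+1 : N ≤ suc (k + k)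
    N≤2k+1 = subst₂ _≤_ (ℕₚ.⌊n/2⌋+⌈n/2⌉≡n N) (ℕₚ.+-suc k k)
                        (ℕₚ.+-monoʳ-≤ k (ℕₚ.⌊n/2⌋-mono (ℕₚ.n≤1+n (suc N))))

    A : Matrix (suc N)
    A i j = diamond k N (toℕ i) (toℕ j)

    at-A : ∀ {i j} → i < suc N → j < suc N → at A i j ≡ diamond k N i j
    at-A i<n j<n =
      trans (at-fromℕ< A _ _ i<n j<n) (cong₂ (diamond k N) (Finₚ.toℕ-fromℕ< i<n) (Finₚ.toℕ-fromℕ< j<n))

    module Row {i} (i<n : i < suc N) where

      open PulseRow (diamond-row {k} {N} 2k≤N N≤2k+1 (ℕₚ.≤-pred i<n)) public

      prefix-bit : ∀ m → Bit (sumTo m (diamond k N i))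
      prefix-bit = sumTo-shifted-bit shape

      total : sumTo (suc N) (diamond k N i) ≡ 1ℤ
      total = sumTo-shifted-total shape (s≤s fits)

      total-χ₋₁ : sumTo (suc N) (χ₋₁ ∘ diamond k N i) ≡ + rowBound (suc N) i
      total-χ₋₁ = sumTo-χ₋₁-shifted shape (s≤s fits)

    sumTo-column : ∀ {m j} → m ≤ suc N → j < suc N → sumTo m (λ i → at A i j) ≡ sumTo m (diamond k N j)
    sumTo-column {m} {j} m≤n j<n =
      sumTo-cong m (λ i i<m → trans (at-A (ℕₚ.<-≤-trans i<m m≤n) j<n) (diamond-sym k N j i))

    sumTo-row : ∀ {m i} → m ≤ suc N → i < suc N → sumTo m (at A i) ≡ sumTo m (diamond k N i)
    sumTo-row {m} {i} m≤n i<n = sumTo-cong m (λ j j<m → at-A i<n (ℕₚ.<-≤-trans j<m m≤n))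

    isSquareSignMatrix : IsSquareSignMatrix (suc N) A
    isSquareSignMatrix = record
      { entries   = λ i j → diamond-sign k N (toℕ i) (toℕ j)
      ; rowSum    = λ i → trans (sumTo-row ℕₚ.≤-refl (Finₚ.toℕ<n i)) (Row.total (Finₚ.toℕ<n i))
      ; colSum    = λ j → trans (sumTo-column ℕₚ.≤-refl (Finₚ.toℕ<n j)) (Row.total (Finₚ.toℕ<n j))
      ; colPrefix = λ i j → subst Bit (sym (sumTo-column (Finₚ.toℕ<n i) (Finₚ.toℕ<n j)))
                                      (Row.prefix-bit (Finₚ.toℕ<n j) (suc (toℕ i)))
      ; rowPrefix = λ i j → subst (0ℤ ℤ.≤_) (sym (sumTo-row (Finₚ.toℕ<n j) (Finₚ.toℕ<n i)))
                                      (proj₁ (Row.prefix-bit (Finₚ.toℕ<n i) (suc (toℕ j))))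
      }

    numMinusOnes-A : numMinusOnes A ≡ maxMinusOnes (suc N)
    numMinusOnes-A = ℤₚ.+-injective (begin
      + numMinusOnes A
        ≡⟨ numMinusOnes≡sumTo A ⟩
      sumTo (suc N) (λ i → sumTo (suc N) (λ j → χ₋₁ (at A i j)))
        ≡⟨ sumTo-cong (suc N) (λ i i<n →
             trans (sumTo-cong (suc N) (λ j j<n → cong χ₋₁ (at-A i<n j<n))) (Row.total-χ₋₁ i<n)) ⟩
      sumTo (suc N) (λ i → + rowBound (suc N) i)
        ≡⟨ sumTo-rowBound (suc N) ⟩
      + maxMinusOnes (suc N)
        ∎)
      where open ≡-Reasoning

open import Data.Nat using (ℕ; suc; _*_; _∸_; _≤_; ⌊_/2⌋; ⌈_/2⌉)
open import Data.Product using (Σ; _×_; _,_)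
open import Relation.Binary.PropositionalEquality using (_≡_)
open ClosedForm using (numMinusOnes≤maxMinusOnes)

lemma3p7 : (n : ℕ) → 1 ≤ n →
    (Σ (Matrix n) λ A → IsSquareSignMatrix n A × numMinusOnes A ≡ ⌊ n ∸ 1 /2⌋ * ⌈ n ∸ 1 /2⌉)
    × ((A : Matrix n) → IsSquareSignMatrix n A → numMinusOnes A ≤ ⌊ n ∸ 1 /2⌋ * ⌈ n ∸ 1 /2⌉)
lemma3p7 (suc N) _ =
  (A N , isSquareSignMatrix N , numMinusOnes-A N) , λ _ → numMinusOnes≤maxMinusOnes
  where open Construction
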